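{- The Forest-Algorithm performs at most $m=|\Lambda|$ phases.
   Context: Let $\Lambda$ be a finite set of atoms with $m=|\Lambda|$, $\{\psi_x\}_{x\in\Lambda}$ mutually independent random variables, and $\mathcal F$ a finite family of tempered events: each $E\in\mathcal F$ is determined by the variables indexed by a proper subset $\mathrm{supp}(E)\subsetneq\Lambda$. For each $E\in\mathcal F$ and $x\in\mathrm{supp}(E)$ a subset $S_x(E)\subsetneq\mathrm{supp}(E)$ with $x\notin S_x(E)$ is fixed. Given an evaluation of the variables, an atom $x$ is bad if some event $E\in\mathcal F$ with $x\in\mathrm{supp}(E)$ occurs, and good otherwise. Total orders on $\Lambda$ and $\mathcal F$ are fixed. Forest-Algorithm: (1) sample all variables; (2) while there is a bad atom, let $x$ be the smallest bad atom and $E$ the smallest occurring event with $x\in\mathrm{supp}(E)$, and call Resample$(x,E)$; (3) output the current evaluation. Resample$(x,E)$: (1) resample all $\psi_y$ with $y\in\mathrm{supp}(E)\setminus S_x(E)$; (2) while there is a bad atom in $\mathrm{supp}(E)\setminus S_x(E)$, let $x'$ be the smallest such atom and $E'$ the smallest occurring event with $x'\in\mathrm{supp}(E')$, and call Resample$(x',E')$. A phase of the Forest-Algorithm is the collection of all resampling steps performed during one call of Resample made directly from line (2) of the Forest-Algorithm (including all nested calls). -}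

module Defs where

open import Data.Nat using (ℕ; zero; suc; _+_)
open import Data.Fin using (Fin) renaming (_≤_ to _≤ᶠ_)
open import Data.Fin.Subset using (Subset; _∈_; _∉_; _⊂_; ⊤)
open import Data.Bool using (Bool; true)
open import Data.List using (List; []; _∷_)
open import Data.Product using (Σ; ∃; _×_; _,_)
open import Relation.Nullary using (¬_)
import Data.Unit
open import Relation.Binary.PropositionalEquality using (_≡_)

-- A setting: atoms Λ = Fin m (total order = the order of Fin m),
-- a variable ψ_x with value space V x for every atom x,
-- a finite family of events F = Fin nE (total order = the order of Fin nE),
-- each event E given by its support, its (decidable) occurrence predicate
-- and the sets S_x(E).
record Setting (m : ℕ) : Set₁ where
  field
    V        : Fin m → Set
    nE       : ℕ
    supp     : Fin nE → Subset m
    occ      : Fin nE → ((x : Fin m) → V x) → Bool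
    S        : Fin nE → Fin m → Subset m
    supp-proper : ∀ E → supp E ⊂ ⊤
    determined  : ∀ E (σ τ : (x : Fin m) → V x) →
                  (∀ x → x ∈ supp E → σ x ≡ τ x) → occ E σ ≡ occ E τ
    S-proper    : ∀ E x → x ∈ supp E → S E x ⊂ supp E
    S-notin     : ∀ E x → x ∈ supp E → x ∉ S E x

module _ {m : ℕ} (P : Setting m) where
  open Setting P

  Eval : Set
  Eval = (x : Fin m) → V x

  Occurs : Fin nE → Eval → Set
  Occurs E σ = occ E σ ≡ true

  Bad : Eval → Fin m → Set
  Bad σ x = ∃ λ E → x ∈ supp E × Occurs E σ

  Good : Eval → Fin m → Set
  Good σ x = ¬ Bad σ x

  -- the atoms whose variables are resampled by Resample(x,E):
  -- supp(E) \ S_x(E)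
  InR : Fin m → Fin nE → Fin m → Set
  InR x E y = y ∈ supp E × y ∉ S E x

  LeastBadIn : (Fin m → Set) → Eval → Fin m → Set
  LeastBadIn A σ x = A x × Bad σ x × (∀ y → A y → Bad σ y → x ≤ᶠ y)

  LeastOcc : Eval → Fin m → Fin nE → Set
  LeastOcc σ x E = x ∈ supp E × Occurs E σ ×
                   (∀ E' → x ∈ supp E' → Occurs E' σ → E ≤ᶠ E')

  -- τ is a possible outcome of resampling the variables indexed by A in σ
  -- (any new values on A, unchanged elsewhere)
  ResampledOn : (Fin m → Set) → Eval → Eval → Set
  ResampledOn A σ τ = ∀ y → ¬ A y → τ y ≡ σ y

  -- machine state: current evaluation and the stack of active
  -- Resample(x,E) calls (innermost first); the empty stack means control
  -- is in the main loop (line (2)) of the Forest-Algorithm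
  record State : Set where
    constructor ⟨_,_⟩
    field
      eval  : Eval
      stack : List (Fin m × Fin nE)

  -- one step of the Forest-Algorithm; the ℕ index is 1 iff the step starts
  -- a new phase (a call of Resample from line (2) of the main algorithm)
  data Step : State → ℕ → State → Set where
    phase  : ∀ {σ τ x E} →
             LeastBadIn (λ _ → Data.Unit.⊤) σ x → LeastOcc σ x E →
             ResampledOn (InR x E) σ τ →
             Step ⟨ σ , [] ⟩ 1 ⟨ τ , (x , E) ∷ [] ⟩
    nested : ∀ {σ τ x E x' E' st} →
             LeastBadIn (InR x E) σ x' → LeastOcc σ x' E' →
             ResampledOn (InR x' E') σ τ →
             Step ⟨ σ , (x , E) ∷ st ⟩ 0 ⟨ τ , (x' , E') ∷ (x , E) ∷ st ⟩
    return : ∀ {σ x E st} →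
             (∀ y → InR x E y → Good σ y) →
             Step ⟨ σ , (x , E) ∷ st ⟩ 0 ⟨ σ , st ⟩

  -- finite executions; the ℕ index counts the phases started
  data Run : State → ℕ → State → Set where
    done : ∀ {s} → Run s 0 s
    step : ∀ {s t u a b} → Step s a t → Run t b u → Run s (a + b) u

module Submission where

-- Idea: every completed phase strictly enlarges the set of good atoms,
-- which lives inside Λ and so can grow at most m times.
--
--  * During a phase started from the evaluation σ₀ we maintain an
--    invariant: every event occurring at the current evaluation either
--    sees exactly the values it saw at σ₀, or its support meets the
--    resampling set supp(E) \ S_x(E) of a Resample(x,E) call that is still
--    active.  Resampling and returning from a call both preserve it.
--  * When the phase ends the stack is empty, so every occurring event
--    already occurred at σ₀: atoms good at σ₀ are still good.  The atom x₀
--    the phase was started for lies in the resampling set of the outermost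
--    call, which returns only once that set is good; x₀ was bad at σ₀.
--    Hence the set of good atoms grows strictly.
--  * A phase interrupted by the end of a finite run started from a bad
--    atom, so then fewer than m atoms were good when it began.

open import Defs
open import Data.Nat using (ℕ; _≤_; _<_; _+_; suc)
open import Data.Nat.Properties using (≤-trans; +-monoʳ-≤; +-suc; m≤m+n)
open import Data.List using (List; []; _∷_)
open import Data.List.Relation.Unary.Any using (Any; here; there)
open import Data.Fin using (Fin)
open import Data.Fin.Properties using (any?)
open import Data.Fin.Subset using (Subset; _∈_; _∉_; _⊆_; _⊂_; ⊤; ∣_∣)
open import Data.Fin.Subset.Properties
  using (_∈?_; ∈⊤; ∣p∣≤n; ∣⊤∣≡n; p⊂q⇒∣p∣<∣q∣)
open import Data.Vec using (tabulate)
open import Data.Vec.Properties using (lookup∘tabulate; lookup⇒[]=; []=⇒lookup)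
open import Data.Bool using (true)
open import Data.Bool.Properties using () renaming (_≟_ to _≟ᵇ_)
open import Data.Product using (∃; _×_; _,_)
open import Data.Sum using (_⊎_; inj₁; inj₂)
open import Data.Empty using (⊥-elim)
open import Level using (Level)
open import Relation.Nullary using (¬_; yes; no; does)
open import Relation.Nullary.Decidable using (_×-dec_; ¬?; dec-true)
open import Relation.Unary using (Pred; Decidable)
open import Relation.Binary.PropositionalEquality
  using (_≡_; refl; sym; trans; subst)

module _ {n : ℕ} {ℓ : Level} {P : Pred (Fin n) ℓ} (P? : Decidable P) where

  fromDec : Subset n
  fromDec = tabulate (λ x → does (P? x))

  ∈-fromDec⁺ : ∀ {x} → P x → x ∈ fromDec
  ∈-fromDec⁺ {x} px =
    lookup⇒[]= x fromDec (trans (lookup∘tabulate _ x) (dec-true (P? x) px))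

  ∈-fromDec⁻ : ∀ {x} → x ∈ fromDec → P x
  ∈-fromDec⁻ {x} x∈ with P? x | trans (sym (lookup∘tabulate _ x)) ([]=⇒lookup x∈)
  ... | yes px | _ = px
  ... | no _   | ()

∉⇒∣p∣<n : ∀ {n} {p : Subset n} {x : Fin n} → x ∉ p → ∣ p ∣ < n
∉⇒∣p∣<n {n} {p} {x} x∉p =
  subst (∣ p ∣ <_) (∣⊤∣≡n n) (p⊂q⇒∣p∣<∣q∣ ((λ _ → ∈⊤) , x , ∈⊤ , x∉p))

module Phases {m : ℕ} (P : Setting m) where
  open Setting P

  Call : Set
  Call = Fin m × Fin nE

  Resamples : Call → Fin m → Set
  Resamples (x , E) = InR P x E

  bad? : ∀ σ → Decidable (Bad P σ)
  bad? σ y = any? (λ E → (y ∈? supp E) ×-dec (occ E σ ≟ᵇ true))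

  goodSet : Eval P → Subset m
  goodSet σ = fromDec (λ y → ¬? (bad? σ y))

  good⇒∈goodSet : ∀ {σ x} → Good P σ x → x ∈ goodSet σ
  good⇒∈goodSet {σ} = ∈-fromDec⁺ (λ y → ¬? (bad? σ y))

  ∈goodSet⇒good : ∀ {σ x} → x ∈ goodSet σ → Good P σ x
  ∈goodSet⇒good {σ} = ∈-fromDec⁻ (λ y → ¬? (bad? σ y))

  Unchanged : Eval P → Eval P → Fin nE → Set
  Unchanged σ₀ σ E = ∀ w → w ∈ supp E → σ w ≡ σ₀ w

  Touched : List Call → Fin nE → Set
  Touched st E = ∃ λ w → w ∈ supp E × Any (λ c → Resamples c w) st

  Accounted : Eval P → Eval P → List Call → Set
  Accounted σ₀ σ st = ∀ E → Occurs P E σ → Unchanged σ₀ σ E ⊎ Touched st E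

  accounted-start : ∀ σ → Accounted σ σ []
  accounted-start σ E _ = inj₁ (λ _ _ → refl)

  untouched-unchanged : ∀ {A : Fin m → Set} {σ τ E} → ResampledOn P A σ τ →
                        ¬ (∃ λ w → w ∈ supp E × A w) → Unchanged σ τ E
  untouched-unchanged resampled disjoint w w∈E =
    resampled w (λ w∈A → disjoint (w , w∈E , w∈A))

  -- Resampling supp(E) \ S_x(E) while pushing Resample(x,E): an event
  -- whose support avoids the resampled atoms did not change, so it already
  -- occurred before and the old invariant accounts for it.
  accounted-resample : ∀ {σ₀ σ τ st x E} → Accounted σ₀ σ st →
                       ResampledOn P (InR P x E) σ τ →
                       Accounted σ₀ τ ((x , E) ∷ st)
  accounted-resample {σ = σ} {τ} {x = x} {E} inv resampled E' occurs
    with any? (λ w → (w ∈? supp E') ×-dec ((w ∈? supp E) ×-dec ¬? (w ∈? S E x)))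
  ... | yes (w , w∈E' , w∈R) = inj₂ (w , w∈E' , here w∈R)
  ... | no disjoint
    with kept ← untouched-unchanged {E = E'} resampled disjoint
    with inv E' (trans (determined E' σ τ (λ w w∈ → sym (kept w w∈))) occurs)
  ... | inj₁ unchanged = inj₁ (λ w w∈ → trans (kept w w∈) (unchanged w w∈))
  ... | inj₂ (w , w∈E' , active) = inj₂ (w , w∈E' , there active)

  -- Returning from a call whose resampling set is good: an occurring event
  -- cannot meet that set, so it is accounted for by the remaining stack.
  accounted-return : ∀ {σ₀ σ c st} → Accounted σ₀ σ (c ∷ st) →
                     (∀ y → Resamples c y → Good P σ y) → Accounted σ₀ σ st
  accounted-return inv good E occurs with inv E occurs
  ... | inj₁ unchanged = inj₁ unchanged
  ... | inj₂ (w , w∈E , here w∈R) = ⊥-elim (good w w∈R (E , w∈E , occurs))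
  ... | inj₂ (w , w∈E , there active) = inj₂ (w , w∈E , active)

  -- With an empty stack every occurring event occurred already at σ₀,
  -- so atoms good at σ₀ are still good.
  goodSet-grows : ∀ {σ₀ σ} → Accounted σ₀ σ [] → goodSet σ₀ ⊆ goodSet σ
  goodSet-grows {σ₀} {σ} inv {x} x∈ = good⇒∈goodSet stillGood
    where
    stillGood : Good P σ x
    stillGood (E , x∈E , occurs) with inv E occurs
    ... | inj₁ unchanged =
          ∈goodSet⇒good x∈ (E , x∈E , trans (determined E σ₀ σ (λ w w∈ → sym (unchanged w w∈))) occurs)
    ... | inj₂ (_ , _ , ())

  phase-progress : ∀ {σ₀ σ x₀} → Bad P σ₀ x₀ → Accounted σ₀ σ [] → Good P σ x₀ →
                   goodSet σ₀ ⊂ goodSet σ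
  phase-progress bad inv good =
    goodSet-grows inv , _ , good⇒∈goodSet good , (λ x₀∈ → ∈goodSet⇒good x₀∈ bad)

  data OutermostResamples (x₀ : Fin m) : List Call → Set where
    outermost : ∀ {c} → Resamples c x₀ → OutermostResamples x₀ (c ∷ [])
    inner     : ∀ {c st} → OutermostResamples x₀ st → OutermostResamples x₀ (c ∷ st)

  phases-from-main : ∀ {σ k s} → Run P ⟨ σ , [] ⟩ k s → k + ∣ goodSet σ ∣ ≤ m

  phases-within : ∀ {σ₀ x₀} → Bad P σ₀ x₀ → ∀ {σ st k s} → Accounted σ₀ σ st →
                  OutermostResamples x₀ st → Run P ⟨ σ , st ⟩ k s →
                  k + suc ∣ goodSet σ₀ ∣ ≤ m

  phases-from-main {σ} done = ∣p∣≤n (goodSet σ)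
  phases-from-main {σ} (step {b = k} (phase {x = x} {E = E} (_ , bad , _) (x∈E , _) resampled) run) =
    subst (_≤ m) (+-suc k ∣ goodSet σ ∣)
      (phases-within bad (accounted-resample (accounted-start σ) resampled)
                     (outermost (x∈E , S-notin E x x∈E)) run)

  phases-within bad _ _ done = ∉⇒∣p∣<n (λ x₀∈ → ∈goodSet⇒good x₀∈ bad)
  phases-within bad inv out (step (nested _ _ resampled) run) =
    phases-within bad (accounted-resample inv resampled) (inner out) run
  phases-within bad inv (inner out) (step (return good) run) =
    phases-within bad (accounted-return inv good) out run
  phases-within bad inv (outermost x₀∈R) (step {b = k} (return good) run) =
    ≤-trans (+-monoʳ-≤ k (p⊂q⇒∣p∣<∣q∣ grown)) (phases-from-main run)
    where
    grown : goodSet _ ⊂ goodSet _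
    grown = phase-progress bad (accounted-return inv good) (good _ x₀∈R)

lemma3 : ∀ {m : ℕ} (P : Setting m) (σ : Eval P) (k : ℕ) (s : State P) →
    Run P ⟨ σ , [] ⟩ k s → k ≤ m
lemma3 P σ k s run = ≤-trans (m≤m+n k _) (Phases.phases-from-main P run)
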